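{- For integers $1\leq k<n$, $\frac{1}{F_{2n}}+\frac{1}{F_{2k-1}}\leq \Bigl(\sum_{i=k}^{n-2}\frac{1}{F_{2i}}\Bigr)+\frac{2}{F_{2n-2}}$ (an empty sum being $0$).
   Context: $F_n$ denotes the Fibonacci numbers: $F_0=0$, $F_1=1$, $F_n=F_{n-1}+F_{n-2}$ for $n>1$. -}

module Defs where

open import Data.Nat using (ℕ; zero; suc; _+_; _∸_)
open import Data.Integer using (+_)
open import Data.Rational using (ℚ; 0ℚ; _/_) renaming (_+_ to _+ℚ_)

fib : ℕ → ℕ
fib zero = zero
fib (suc zero) = suc zero
fib (suc (suc n)) = fib (suc n) + fib n

-- reciprocal 1/d of a natural number as a rational; the value at d = 0
-- is a junk value 0 (never used in the statement, all denominators are positive)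
recip : ℕ → ℚ
recip zero = 0ℚ
recip (suc d) = (+ 1) / suc d

sumFrom : ℕ → ℕ → (ℕ → ℚ) → ℚ
sumFrom a zero f = 0ℚ
sumFrom a (suc len) f = f a +ℚ sumFrom (suc a) len f

-- Σ_{i=k}^{m} f i, which is 0 when m < k
sumRange : ℕ → ℕ → (ℕ → ℚ) → ℚ
sumRange k m f = sumFrom k (suc m ∸ k) f

-- Cassini's identity F(2m+1) F(2m+3) = F(2m+2)² + 1 gives, after cross-multiplying,
-- 1/F(2i-1) ≤ 1/F(2i) + 1/F(2i+1). Telescoping this from i = k to n-2 bounds 1/F(2k-1)
-- by the sum plus 1/F(2n-3), and the same identity gives 1/F(2n) + 1/F(2n-3) ≤ 2/F(2n-2).
module Submission where

open import Defs
open import Data.Nat using (ℕ; zero; suc; _+_; _*_; _∸_; _≤_; _<_; s≤s; z≤n)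
import Data.Nat.Properties as ℕP
open import Data.Nat.Tactic.RingSolver using (solve-∀; solve)
open import Data.List using (_∷_; [])
open import Data.Integer using (+_; +≤+)
open import Data.Rational using (ℚ; toℚᵘ; 0ℚ; 1ℚ; _/_) renaming (_+_ to _+ℚ_; _≤_ to _≤ℚ_; _*_ to _*ℚ_)
import Data.Rational.Properties as ℚP
open import Data.Rational.Unnormalised as U using (ℚᵘ; mkℚᵘ; _≃_)
import Data.Rational.Unnormalised.Properties as UP
open import Algebra.Bundles using (CommutativeMonoid)
open import Algebra.Properties.CommutativeSemigroup
  (CommutativeMonoid.commutativeSemigroup ℚP.+-0-commutativeMonoid) using (x∙yz≈y∙xz)
open import Data.Product using (_,_)
open import Relation.Binary.PropositionalEquality

toℚᵘ-recip : ∀ a → toℚᵘ (recip (suc a)) ≃ mkℚᵘ (+ 1) a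
toℚᵘ-recip a = ℚP.toℚᵘ-fromℚᵘ (mkℚᵘ (+ 1) a)

toℚᵘ-recip-+ : ∀ a b → toℚᵘ (recip (suc a) +ℚ recip (suc b)) ≃ mkℚᵘ (+ 1) a U.+ mkℚᵘ (+ 1) b
toℚᵘ-recip-+ a b = UP.≃-trans (ℚP.toℚᵘ-homo-+ (recip (suc a)) (recip (suc b)))
                              (UP.+-cong (toℚᵘ-recip a) (toℚᵘ-recip b))

≤-from-ℚᵘ : ∀ {p q : ℚ} {x y : ℚᵘ} → toℚᵘ p ≃ x → toℚᵘ q ≃ y → x U.≤ y → p ≤ℚ q
≤-from-ℚᵘ p≃x q≃y x≤y = ℚP.toℚᵘ-cancel-≤ (UP.≤-respˡ-≃ (UP.≃-sym p≃x) (UP.≤-respʳ-≃ (UP.≃-sym q≃y) x≤y))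

recip-≤-recip-+ : ∀ {a c d} → 0 < a → 0 < c → 0 < d → c * d ≤ a * (c + d) →
                  recip a ≤ℚ recip c +ℚ recip d
recip-≤-recip-+ {suc a} {suc c} {suc d} _ _ _ cd≤a[c+d] =
  ≤-from-ℚᵘ (toℚᵘ-recip a) (toℚᵘ-recip-+ c d) (U.*≤* (+≤+ cross-multiplied))
  where
  reorder : ∀ a c d → a * (c + d) ≡ (1 * d + 1 * c) * a
  reorder = solve-∀
  cross-multiplied : 1 * (suc c * suc d) ≤ (1 * suc d + 1 * suc c) * suc a
  cross-multiplied = subst₂ _≤_ (sym (ℕP.*-identityˡ (suc c * suc d))) (reorder (suc a) (suc c) (suc d)) cd≤a[c+d]

recip-+-≤-recip-+ : ∀ {a b c d} → 0 < a → 0 < b → 0 < c → 0 < d → (a + b) * (c * d) ≤ (c + d) * (a * b) →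
                    recip a +ℚ recip b ≤ℚ recip c +ℚ recip d
recip-+-≤-recip-+ {suc a} {suc b} {suc c} {suc d} _ _ _ _ [a+b]cd≤[c+d]ab =
  ≤-from-ℚᵘ (toℚᵘ-recip-+ a b) (toℚᵘ-recip-+ c d) (U.*≤* (+≤+ cross-multiplied))
  where
  reorder : ∀ a b x → (a + b) * x ≡ (1 * b + 1 * a) * x
  reorder = solve-∀
  cross-multiplied : (1 * suc b + 1 * suc a) * (suc c * suc d) ≤ (1 * suc d + 1 * suc c) * (suc a * suc b)
  cross-multiplied = subst₂ _≤_ (reorder (suc a) (suc b) _) (reorder (suc c) (suc d) _) [a+b]cd≤[c+d]ab

2*p≡p+p : ∀ p → ((+ 2) / 1) *ℚ p ≡ p +ℚ p
2*p≡p+p p = begin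
  ((+ 2) / 1) *ℚ p    ≡⟨⟩
  (1ℚ +ℚ 1ℚ) *ℚ p     ≡⟨ ℚP.*-distribʳ-+ p 1ℚ 1ℚ ⟩
  1ℚ *ℚ p +ℚ 1ℚ *ℚ p  ≡⟨ cong₂ _+ℚ_ (ℚP.*-identityˡ p) (ℚP.*-identityˡ p) ⟩
  p +ℚ p              ∎
  where open ≡-Reasoning

sumFrom-telescope-≤ : (f g : ℕ → ℚ) → (∀ i → g i ≤ℚ f (suc i) +ℚ g (suc i)) →
                      ∀ k j → g k ≤ℚ sumFrom (suc k) j f +ℚ g (k + j)
sumFrom-telescope-≤ f g step k zero = ℚP.≤-reflexive (begin
  g k               ≡⟨ cong g (sym (ℕP.+-identityʳ k)) ⟩
  g (k + 0)         ≡⟨ sym (ℚP.+-identityˡ (g (k + 0))) ⟩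
  0ℚ +ℚ g (k + 0)   ∎)
  where open ≡-Reasoning
sumFrom-telescope-≤ f g step k (suc j) = begin
  g k                                          ≤⟨ step k ⟩
  f (suc k) +ℚ g (suc k)                       ≤⟨ ℚP.+-monoʳ-≤ (f (suc k)) (sumFrom-telescope-≤ f g step (suc k) j) ⟩
  f (suc k) +ℚ (S +ℚ g (suc k + j))            ≡⟨ ℚP.+-assoc (f (suc k)) S _ ⟨
  sumFrom (suc k) (suc j) f +ℚ g (suc (k + j)) ≡⟨ cong (λ i → sumFrom (suc k) (suc j) f +ℚ g i) (ℕP.+-suc k j) ⟨
  sumFrom (suc k) (suc j) f +ℚ g (k + suc j)   ∎
  where
  open ℚP.≤-Reasoning
  S = sumFrom (suc (suc k)) j f

fib-pos : ∀ n → 0 < fib (suc n)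
fib-pos zero    = s≤s z≤n
fib-pos (suc n) = ℕP.≤-trans (fib-pos n) (ℕP.m≤m+n (fib (suc n)) (fib n))

fib-cross-step : ∀ n → fib (1 + n) * fib (3 + n) + fib n * fib (2 + n)
                     ≡ fib (2 + n) * fib (2 + n) + fib (1 + n) * fib (1 + n)
fib-cross-step n = identity (fib n) (fib (1 + n))
  where
  identity : ∀ x y → y * ((y + x) + y) + x * (y + x) ≡ (y + x) * (y + x) + y * y
  identity = solve-∀

x+[y+1]≡[x+1]+y : ∀ x y → x + (y + 1) ≡ (x + 1) + y
x+[y+1]≡[x+1]+y = solve-∀

cassini-odd-from-even : ∀ t → fib (1 + t) * fib (1 + t) ≡ fib t * fib (2 + t) + 1 →
                        fib (1 + t) * fib (3 + t) ≡ fib (2 + t) * fib (2 + t) + 1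
cassini-odd-from-even t even = ℕP.+-cancelʳ-≡ (F₀ * F₂) _ _ (begin
  F₁ * F₃ + F₀ * F₂        ≡⟨ fib-cross-step t ⟩
  F₂ * F₂ + F₁ * F₁        ≡⟨ cong (_+_ (F₂ * F₂)) even ⟩
  F₂ * F₂ + (F₀ * F₂ + 1)  ≡⟨ x+[y+1]≡[x+1]+y (F₂ * F₂) (F₀ * F₂) ⟩
  F₂ * F₂ + 1 + F₀ * F₂    ∎)
  where
  open ≡-Reasoning
  F₀ = fib t
  F₁ = fib (1 + t)
  F₂ = fib (2 + t)
  F₃ = fib (3 + t)

cassini-even-from-odd : ∀ t → fib (1 + t) * fib (3 + t) ≡ fib (2 + t) * fib (2 + t) + 1 →
                        fib (3 + t) * fib (3 + t) ≡ fib (2 + t) * fib (4 + t) + 1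
cassini-even-from-odd t odd = ℕP.+-cancelʳ-≡ (F₂ * F₂) _ _ (begin
  F₃ * F₃ + F₂ * F₂        ≡⟨ fib-cross-step (1 + t) ⟨
  F₂ * F₄ + F₁ * F₃        ≡⟨ cong (_+_ (F₂ * F₄)) odd ⟩
  F₂ * F₄ + (F₂ * F₂ + 1)  ≡⟨ x+[y+1]≡[x+1]+y (F₂ * F₄) (F₂ * F₂) ⟩
  F₂ * F₄ + 1 + F₂ * F₂    ∎)
  where
  open ≡-Reasoning
  F₁ = fib (1 + t)
  F₂ = fib (2 + t)
  F₃ = fib (3 + t)
  F₄ = fib (4 + t)

fib-cassini-even : ∀ m → fib (1 + 2 * m) * fib (1 + 2 * m) ≡ fib (2 * m) * fib (2 + 2 * m) + 1
fib-cassini-even zero    = refl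
fib-cassini-even (suc m) = subst (λ t → fib (1 + t) * fib (1 + t) ≡ fib t * fib (2 + t) + 1)
  (sym (ℕP.*-suc 2 m))
  (cassini-even-from-odd (2 * m) (cassini-odd-from-even (2 * m) (fib-cassini-even m)))

fib-cassini-odd : ∀ m → fib (1 + 2 * m) * fib (3 + 2 * m) ≡ fib (2 + 2 * m) * fib (2 + 2 * m) + 1
fib-cassini-odd m = cassini-odd-from-even (2 * m) (fib-cassini-even m)

recip-fib-odd-step : ∀ m → recip (fib (1 + 2 * m)) ≤ℚ recip (fib (2 + 2 * m)) +ℚ recip (fib (3 + 2 * m))
recip-fib-odd-step m = recip-≤-recip-+ (fib-pos t) (fib-pos (1 + t)) (fib-pos (2 + t))
  (cross-multiplied (fib (1 + t)) (fib (2 + t)) (fib-cassini-odd m))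
  where
  t = 2 * m
  -- fib (3 + t) unfolds definitionally to c + a.
  cross-multiplied : ∀ a c → a * (c + a) ≡ c * c + 1 → c * (c + a) ≤ a * (c + (c + a))
  cross-multiplied a c cassini = begin
    c * (c + a)            ≤⟨ ℕP.m≤m+n (c * (c + a)) 1 ⟩
    c * (c + a) + 1        ≡⟨ solve (a ∷ c ∷ []) ⟩
    (c * c + 1) + c * a    ≡⟨ cong (λ x → x + c * a) (sym cassini) ⟩
    a * (c + a) + c * a    ≡⟨ solve (a ∷ c ∷ []) ⟩
    a * (c + (c + a))      ∎
    where open ℕP.≤-Reasoning

recip-fib-final-step : ∀ m → recip (fib (4 + 2 * m)) +ℚ recip (fib (1 + 2 * m))
                           ≤ℚ recip (fib (2 + 2 * m)) +ℚ recip (fib (2 + 2 * m))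
recip-fib-final-step m = recip-+-≤-recip-+ (fib-pos (3 + t)) (fib-pos t) (fib-pos (1 + t)) (fib-pos (1 + t))
  (cross-multiplied (fib (1 + t)) (fib (2 + t)) (fib-cassini-odd m))
  where
  t = 2 * m
  cross-multiplied : ∀ a y → a * (y + a) ≡ y * y + 1 →
                     ((y + a) + y + a) * (y * y) ≤ (y + y) * (((y + a) + y) * a)
  cross-multiplied a y cassini = begin
    ((y + a) + y + a) * (y * y)                  ≤⟨ ℕP.m≤m+n (((y + a) + y + a) * (y * y)) (y + y) ⟩
    ((y + a) + y + a) * (y * y) + (y + y)        ≡⟨ solve (a ∷ y ∷ []) ⟩
    (y + y) * (y * y + 1) + 2 * a * y * y        ≡⟨ cong (λ x → (y + y) * x + 2 * a * y * y) (sym cassini) ⟩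
    (y + y) * (a * (y + a)) + 2 * a * y * y      ≡⟨ solve (a ∷ y ∷ []) ⟩
    (y + y) * (((y + a) + y) * a)                ∎
    where open ℕP.≤-Reasoning

lemma12 : (k n : ℕ) → 1 ≤ k → k < n →
    recip (fib (2 * n)) +ℚ recip (fib (2 * k ∸ 1))
      ≤ℚ sumRange k (n ∸ 2) (λ i → recip (fib (2 * i))) +ℚ ((+ 2) / 1) *ℚ recip (fib (2 * n ∸ 2))
lemma12 (suc k) n (s≤s z≤n) k<n with ℕP.m≤n⇒∃[o]m+o≡n k<n
... | j , refl = begin
  recip (fib (2 * (2 + m))) +ℚ recip (fib (2 * suc k ∸ 1))
    ≡⟨ cong₂ _+ℚ_ (cong (λ x → recip (fib x)) 2*[2+m]) (cong (λ x → recip (fib (x ∸ 1))) (ℕP.*-suc 2 k)) ⟩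
  A +ℚ g k              ≤⟨ ℚP.+-monoʳ-≤ A (sumFrom-telescope-≤ f g step k j) ⟩
  A +ℚ (S +ℚ g m)       ≡⟨ x∙yz≈y∙xz A S (g m) ⟩
  S +ℚ (A +ℚ g m)       ≤⟨ ℚP.+-monoʳ-≤ S (recip-fib-final-step m) ⟩
  S +ℚ (Y +ℚ Y)
    ≡⟨ cong₂ _+ℚ_ (cong (λ l → sumFrom (suc k) l f) (ℕP.m+n∸m≡n k j))
                  (trans (cong (λ x → ((+ 2) / 1) *ℚ recip (fib (x ∸ 2))) 2*[2+m]) (2*p≡p+p Y)) ⟨
  sumRange (suc k) m f +ℚ ((+ 2) / 1) *ℚ recip (fib (2 * (2 + m) ∸ 2)) ∎
  where
  open ℚP.≤-Reasoning
  m = k + j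
  f g : ℕ → ℚ
  f i = recip (fib (2 * i))
  g i = recip (fib (1 + 2 * i))
  step : ∀ i → g i ≤ℚ f (suc i) +ℚ g (suc i)
  step i = subst (λ t → g i ≤ℚ recip (fib t) +ℚ recip (fib (1 + t))) (sym (ℕP.*-suc 2 i)) (recip-fib-odd-step i)
  2*[2+m] : 2 * (2 + m) ≡ 4 + 2 * m
  2*[2+m] = ℕP.*-distribˡ-+ 2 2 m
  A = recip (fib (4 + 2 * m))
  S = sumFrom (suc k) j f
  Y = recip (fib (2 + 2 * m))
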